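{- For every integer $d \geq 3$, the undirected de Bruijn graph $\mathcal{B}(d,3)$ is $2$-identifiable.
   Context: Let $[d]=\{0,1,\ldots,d-1\}$. The undirected de Bruijn graph $\mathcal{B}(d,n)$ has vertex set the set of all strings of length $n$ over $[d]$, and for each string $x_1x_2\ldots x_{n+1}$ over $[d]$ an (undirected) edge joining $x_1\ldots x_n$ and $x_2\ldots x_{n+1}$. For a vertex $x$, $B_t(x)$ is the set of vertices at graph distance at most $t$ from $x$. A subset $S$ of vertices of a graph is a $t$-identifying code if $B_t(x)\cap S\neq\emptyset$ for every vertex $x$ and $B_t(x)\cap S\neq B_t(y)\cap S$ for all distinct vertices $x,y$. A graph is $t$-identifiable if it has a $t$-identifying code. -}

module Defs where

open import Data.Nat using (ℕ; zero; suc)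
open import Data.Fin using (Fin)
open import Data.Vec using (Vec; _∷_; _∷ʳ_)
open import Data.Bool using (Bool; true)
open import Data.Product using (Σ; ∃; ∃-syntax; _×_)
open import Data.Sum using (_⊎_)
open import Relation.Binary.PropositionalEquality using (_≡_; _≢_)
open import Relation.Nullary using (¬_)
open import Function.Bundles using (_⇔_)

Vertex : ℕ → ℕ → Set
Vertex d n = Vec (Fin d) n

-- Directed de Bruijn arc: there is a string x₁…x_{n+1} with
-- u = x₁…x_n and v = x₂…x_{n+1}, i.e. u ∷ʳ b ≡ a ∷ v for some letters a b.
Arc : {d n : ℕ} → Vertex d n → Vertex d n → Set
Arc u v = ∃[ a ] ∃[ b ] (u ∷ʳ b ≡ a ∷ v)

Adj : {d n : ℕ} → Vertex d n → Vertex d n → Set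
Adj u v = Arc u v ⊎ Arc v u

Within : {d n : ℕ} → ℕ → Vertex d n → Vertex d n → Set
Within zero    u v = u ≡ v
Within {d} {n} (suc t) u v =
  Within t u v ⊎ (∃[ w ] (Within t u w × Adj {d} {n} w v))

IsIdentifyingCode : (d n t : ℕ) → (Vertex d n → Bool) → Set
IsIdentifyingCode d n t S =
  ((x : Vertex d n) → ∃[ z ] (S z ≡ true × Within t x z))
  × ((x y : Vertex d n) → x ≢ y →
       ¬ ((z : Vertex d n) → S z ≡ true → (Within t x z ⇔ Within t y z)))

Identifiable : (d n t : ℕ) → Set
Identifiable d n t = Σ (Vertex d n → Bool) (IsIdentifyingCode d n t)

-- Take the whole vertex set as the code: it is 2-identifying as soon as the
-- balls B₂(x) are pairwise distinct. In B(d,3) every vertex of B₂(abc) has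
-- one of the seven shapes abc, bc∗, ∗ab, c∗∗, ∗∗a, ∗bc, ab∗. For x ≠ y a
-- vertex of one ball escaping all seven shapes of the other is built by
-- filling the free positions with letters avoiding at most two given letters,
-- which is possible because d ≥ 3. String reversal is an automorphism of
-- B(d,n), so it suffices to treat x and y with different last letters, and
-- x, y differing only in the middle letter.
module Submission where

open import Defs
open import Data.Nat using (ℕ; zero; suc; _≤_; s≤s)
open import Data.Fin using (Fin; _≟_)
open import Data.Fin.Patterns using (0F; 1F; 2F)
open import Data.Vec using (Vec; []; _∷_; _∷ʳ_; reverse)
open import Data.Vec.Properties using (reverse-∷; reverse-involutive)
open import Data.Bool using (true)
open import Data.Product using (∃-syntax; _×_; _,_; proj₁; proj₂)
open import Data.Sum using (_⊎_; inj₁; inj₂)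
open import Relation.Binary.PropositionalEquality
  using (_≡_; _≢_; refl; sym; cong; subst₂; module ≡-Reasoning)
open import Relation.Nullary using (¬_; yes; no)
open import Function.Base using (_∘_)
open import Function.Bundles using (_⇔_; Equivalence)

private
  variable
    d n t : ℕ

Separates : ℕ → Vertex d n → Vertex d n → Set
Separates t x y = ∃[ z ] (Within t x z × ¬ Within t y z)

within-refl : ∀ t (x : Vertex d n) → Within t x x
within-refl zero    x = refl
within-refl (suc t) x = inj₁ (within-refl t x)

within-step : {x y z : Vertex d n} → Within t x y → Adj y z → Within (suc t) x z
within-step x~y y~z = inj₂ (_ , x~y , y~z)

all-vertices-identify :
  ((x y : Vertex d n) → x ≢ y → Separates t x y ⊎ Separates t y x) →
  IsIdentifyingCode d n t (λ _ → true)
all-vertices-identify {t = t} separate =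
  (λ x → x , refl , within-refl t x) , identify
  where
  identify : ∀ x y → x ≢ y → ¬ (∀ z → true ≡ true → (Within t x z ⇔ Within t y z))
  identify x y x≢y same with separate x y x≢y
  ... | inj₁ (z , x~z , y≁z) = y≁z (Equivalence.to   (same z refl) x~z)
  ... | inj₂ (z , y~z , x≁z) = x≁z (Equivalence.from (same z refl) y~z)

reverse-∷ʳ : ∀ {A : Set} (xs : Vec A n) x → reverse (xs ∷ʳ x) ≡ x ∷ reverse xs
reverse-∷ʳ xs x = begin
  reverse (xs ∷ʳ x)                     ≡⟨ cong (λ ys → reverse (ys ∷ʳ x)) (reverse-involutive xs) ⟨
  reverse (reverse (reverse xs) ∷ʳ x)   ≡⟨ cong reverse (reverse-∷ x (reverse xs)) ⟨
  reverse (reverse (x ∷ reverse xs))    ≡⟨ reverse-involutive (x ∷ reverse xs) ⟩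
  x ∷ reverse xs                        ∎
  where open ≡-Reasoning

Arc-reverse : {u v : Vertex d n} → Arc u v → Arc (reverse v) (reverse u)
Arc-reverse {u = u} {v} (a , b , u∷ʳb≡a∷v) = b , a , (begin
  reverse v ∷ʳ a     ≡⟨ reverse-∷ a v ⟨
  reverse (a ∷ v)    ≡⟨ cong reverse u∷ʳb≡a∷v ⟨
  reverse (u ∷ʳ b)   ≡⟨ reverse-∷ʳ u b ⟩
  b ∷ reverse u      ∎)
  where open ≡-Reasoning

Adj-reverse : {u v : Vertex d n} → Adj u v → Adj (reverse u) (reverse v)
Adj-reverse (inj₁ uv) = inj₂ (Arc-reverse uv)
Adj-reverse (inj₂ vu) = inj₁ (Arc-reverse vu)

Within-reverse : ∀ t {u v : Vertex d n} → Within t u v → Within t (reverse u) (reverse v)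
Within-reverse zero    refl                   = refl
Within-reverse (suc t) (inj₁ u~v)             = inj₁ (Within-reverse t u~v)
Within-reverse (suc t) (inj₂ (_ , u~w , w~v)) = within-step (Within-reverse t u~w) (Adj-reverse w~v)

Separates-reverse : {x y : Vertex d n} → Separates t (reverse x) (reverse y) → Separates t x y
Separates-reverse {t = t} {x = x} {y} (z , rx~z , ry≁z) =
  reverse z
  , subst₂ (Within t) (reverse-involutive x) refl (Within-reverse t rx~z)
  , λ y~rz → ry≁z (subst₂ (Within t) refl (reverse-involutive z) (Within-reverse t y~rz))

fresh-letter : 3 ≤ d → (s s′ : Fin d) → ∃[ v ] (v ≢ s × v ≢ s′)
fresh-letter (s≤s (s≤s (s≤s _))) s s′ with 0F ≟ s | 0F ≟ s′ | 1F ≟ s | 1F ≟ s′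
... | no 0≢s   | no 0≢s′  | _        | _         = 0F , 0≢s , 0≢s′
... | _        | _        | no 1≢s   | no 1≢s′   = 1F , 1≢s , 1≢s′
... | yes refl | _        | yes ()   | _
... | yes refl | _        | no _     | yes refl  = 2F , (λ ()) , (λ ())
... | no _     | yes refl | yes refl | _         = 2F , (λ ()) , (λ ())
... | no _     | yes refl | no _     | yes ()

module _ {d : ℕ} where

  V : Set
  V = Vertex d 3

  private
    variable
      a b c e f g u v : Fin d

  data Near₂ : V → V → Set where
    here             : Near₂ (a ∷ b ∷ c ∷ []) (a ∷ b ∷ c ∷ [])
    forward          : Near₂ (a ∷ b ∷ c ∷ []) (b ∷ c ∷ v ∷ [])
    backward         : Near₂ (a ∷ b ∷ c ∷ []) (u ∷ a ∷ b ∷ [])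
    forward²         : Near₂ (a ∷ b ∷ c ∷ []) (c ∷ u ∷ v ∷ [])
    backward²        : Near₂ (a ∷ b ∷ c ∷ []) (u ∷ v ∷ a ∷ [])
    forward-backward : Near₂ (a ∷ b ∷ c ∷ []) (u ∷ b ∷ c ∷ [])
    backward-forward : Near₂ (a ∷ b ∷ c ∷ []) (a ∷ b ∷ v ∷ [])

  Adj⇒Near₂ : {x z : V} → Adj x z → Near₂ x z
  Adj⇒Near₂ {_ ∷ _ ∷ _ ∷ []}     (inj₁ (_ , _ , refl)) = forward
  Adj⇒Near₂ {_} {_ ∷ _ ∷ _ ∷ []} (inj₂ (_ , _ , refl)) = backward

  Adj²⇒Near₂ : {x y z : V} → Adj x y → Adj y z → Near₂ x z
  Adj²⇒Near₂ {_ ∷ _ ∷ _ ∷ []} {_ ∷ _ ∷ _ ∷ []} {_ ∷ _ ∷ _ ∷ []}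
    (inj₁ (_ , _ , refl)) (inj₁ (_ , _ , refl)) = forward²
  Adj²⇒Near₂ {_ ∷ _ ∷ _ ∷ []} {_ ∷ _ ∷ _ ∷ []} {_ ∷ _ ∷ _ ∷ []}
    (inj₁ (_ , _ , refl)) (inj₂ (_ , _ , refl)) = forward-backward
  Adj²⇒Near₂ {_ ∷ _ ∷ _ ∷ []} {_ ∷ _ ∷ _ ∷ []} {_ ∷ _ ∷ _ ∷ []}
    (inj₂ (_ , _ , refl)) (inj₁ (_ , _ , refl)) = backward-forward
  Adj²⇒Near₂ {_ ∷ _ ∷ _ ∷ []} {_ ∷ _ ∷ _ ∷ []} {_ ∷ _ ∷ _ ∷ []}
    (inj₂ (_ , _ , refl)) (inj₂ (_ , _ , refl)) = backward²

  Within₂⇒Near₂ : {x z : V} → Within 2 x z → Near₂ x z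
  Within₂⇒Near₂ {_ ∷ _ ∷ _ ∷ []} (inj₁ (inj₁ refl))     = here
  Within₂⇒Near₂ (inj₁ (inj₂ (_ , refl , x~z)))           = Adj⇒Near₂ x~z
  Within₂⇒Near₂ (inj₂ (_ , inj₁ refl , x~z))             = Adj⇒Near₂ x~z
  Within₂⇒Near₂ (inj₂ (_ , inj₂ (_ , refl , x~y) , y~z)) = Adj²⇒Near₂ x~y y~z

  forward-Adj : (a b c v : Fin d) → Adj (a ∷ b ∷ c ∷ []) (b ∷ c ∷ v ∷ [])
  forward-Adj a b c v = inj₁ (a , v , refl)

  backward-Adj : (u a b c : Fin d) → Adj (a ∷ b ∷ c ∷ []) (u ∷ a ∷ b ∷ [])
  backward-Adj u a b c = inj₂ (u , c , refl)

  within₂ : {x y z : V} → Adj x y → Adj y z → Within 2 x z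
  within₂ x~y y~z = within-step (within-step refl x~y) y~z

  ¬Near₂-forward² : c ≢ g → u ≢ f → u ≢ g → v ≢ e → v ≢ f →
                    ¬ Near₂ (e ∷ f ∷ g ∷ []) (c ∷ u ∷ v ∷ [])
  ¬Near₂-forward² c≢g u≢f u≢g v≢e v≢f here             = u≢f refl
  ¬Near₂-forward² c≢g u≢f u≢g v≢e v≢f forward          = u≢g refl
  ¬Near₂-forward² c≢g u≢f u≢g v≢e v≢f backward         = v≢f refl
  ¬Near₂-forward² c≢g u≢f u≢g v≢e v≢f forward²         = c≢g refl
  ¬Near₂-forward² c≢g u≢f u≢g v≢e v≢f backward²        = v≢e refl
  ¬Near₂-forward² c≢g u≢f u≢g v≢e v≢f forward-backward = u≢f refl
  ¬Near₂-forward² c≢g u≢f u≢g v≢e v≢f backward-forward = u≢f refl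

  ¬Near₂-backward-forward : a ≢ c → b ≢ e → ¬ (a ≡ e × b ≡ c) → v ≢ a → v ≢ e →
                            ¬ Near₂ (a ∷ e ∷ c ∷ []) (a ∷ b ∷ v ∷ [])
  ¬Near₂-backward-forward a≢c b≢e ¬a≡e×b≡c v≢a v≢e here             = b≢e refl
  ¬Near₂-backward-forward a≢c b≢e ¬a≡e×b≡c v≢a v≢e forward          = ¬a≡e×b≡c (refl , refl)
  ¬Near₂-backward-forward a≢c b≢e ¬a≡e×b≡c v≢a v≢e backward         = v≢e refl
  ¬Near₂-backward-forward a≢c b≢e ¬a≡e×b≡c v≢a v≢e forward²         = a≢c refl
  ¬Near₂-backward-forward a≢c b≢e ¬a≡e×b≡c v≢a v≢e backward²        = v≢a refl
  ¬Near₂-backward-forward a≢c b≢e ¬a≡e×b≡c v≢a v≢e forward-backward = b≢e refl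
  ¬Near₂-backward-forward a≢c b≢e ¬a≡e×b≡c v≢a v≢e backward-forward = b≢e refl

  ¬Near₂-forward : b ≢ a → b ≢ e → v ≢ a → v ≢ e →
                   ¬ Near₂ (a ∷ e ∷ a ∷ []) (b ∷ a ∷ v ∷ [])
  ¬Near₂-forward b≢a b≢e v≢a v≢e here             = b≢a refl
  ¬Near₂-forward b≢a b≢e v≢a v≢e forward          = b≢e refl
  ¬Near₂-forward b≢a b≢e v≢a v≢e backward         = v≢e refl
  ¬Near₂-forward b≢a b≢e v≢a v≢e forward²         = b≢a refl
  ¬Near₂-forward b≢a b≢e v≢a v≢e backward²        = v≢a refl
  ¬Near₂-forward b≢a b≢e v≢a v≢e forward-backward = v≢a refl
  ¬Near₂-forward b≢a b≢e v≢a v≢e backward-forward = b≢a refl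

  separates-forward² : 3 ≤ d → ∀ a b c e f g → c ≢ g →
                       Separates 2 (a ∷ b ∷ c ∷ []) (e ∷ f ∷ g ∷ [])
  separates-forward² h a b c e f g c≢g =
    let u , u≢f , u≢g = fresh-letter h f g
        v , v≢e , v≢f = fresh-letter h e f
    in  c ∷ u ∷ v ∷ []
      , within₂ (forward-Adj a b c u) (forward-Adj b c u v)
      , ¬Near₂-forward² c≢g u≢f u≢g v≢e v≢f ∘ Within₂⇒Near₂

  separates-backward-forward : 3 ≤ d → ∀ a b c e → a ≢ c → b ≢ e → ¬ (a ≡ e × b ≡ c) →
                     Separates 2 (a ∷ b ∷ c ∷ []) (a ∷ e ∷ c ∷ [])
  separates-backward-forward h a b c e a≢c b≢e ¬a≡e×b≡c =
    let v , v≢a , v≢e = fresh-letter h a e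
    in  a ∷ b ∷ v ∷ []
      , within₂ (backward-Adj v a b c) (forward-Adj v a b v)
      , ¬Near₂-backward-forward a≢c b≢e ¬a≡e×b≡c v≢a v≢e ∘ Within₂⇒Near₂

  separates-forward : 3 ≤ d → ∀ a b e → b ≢ a → b ≢ e →
                         Separates 2 (a ∷ b ∷ a ∷ []) (a ∷ e ∷ a ∷ [])
  separates-forward h a b e b≢a b≢e =
    let v , v≢a , v≢e = fresh-letter h a e
    in  b ∷ a ∷ v ∷ []
      , inj₁ (within-step refl (forward-Adj a b a v))
      , ¬Near₂-forward b≢a b≢e v≢a v≢e ∘ Within₂⇒Near₂

  separates-same-ends : 3 ≤ d → ∀ a b c e → b ≢ e →
                        Separates 2 (a ∷ b ∷ c ∷ []) (a ∷ e ∷ c ∷ [])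
                        ⊎ Separates 2 (a ∷ e ∷ c ∷ []) (a ∷ b ∷ c ∷ [])
  separates-same-ends h a b c e b≢e with a ≟ c | a ≟ e | b ≟ a
  ... | no a≢c   | no a≢e   | _        = inj₁ (separates-backward-forward h a b c e a≢c b≢e (a≢e ∘ proj₁))
  ... | no a≢c   | yes refl | _        = inj₂ (separates-backward-forward h a a c b a≢c (b≢e ∘ sym) (a≢c ∘ proj₂))
  ... | yes refl | _        | no b≢a   = inj₁ (separates-forward h a b e b≢a b≢e)
  ... | yes refl | _        | yes refl = inj₂ (separates-forward h a e a (b≢e ∘ sym) (b≢e ∘ sym))

  separated : 3 ≤ d → (x y : V) → x ≢ y → Separates 2 x y ⊎ Separates 2 y x
  separated h (a ∷ b ∷ c ∷ []) (e ∷ f ∷ g ∷ []) x≢y with c ≟ g | a ≟ e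
  ... | no c≢g   | _        = inj₁ (separates-forward² h a b c e f g c≢g)
  ... | yes refl | no a≢e   = inj₁ (Separates-reverse (separates-forward² h c b a g f e a≢e))
  ... | yes refl | yes refl = separates-same-ends h a b c f (x≢y ∘ cong (λ m → a ∷ m ∷ c ∷ []))

mainTheorem3 : (d : ℕ) → 3 ≤ d → Identifiable d 3 2
mainTheorem3 d h = (λ _ → true) , all-vertices-identify (separated h)
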